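{- Let $q$ be a power of an odd prime, let $\lambda\in\mathbb{F}_q$ be a non-square, and let $f\in\mathbb{F}_q[X]$ be a permutation polynomial of $\mathbb{F}_q$. Then $\mathcal{G}(\lambda,f)$ is not a bipartite graph, i.e. there is no partition of $\mathbb{F}_q$ into two sets $S_1,S_2$ such that no edge (including loops) has both endpoints in $S_1$ or both endpoints in $S_2$.
   Context: For a polynomial $f\in\mathbb{F}_q[X]$ and a non-square $\lambda\in\mathbb{F}_q$, $\mathcal{G}(\lambda,f)$ is the directed graph whose vertex set is $\mathbb{F}_q$, with an edge from $x$ to $y$ if and only if $(y^2-f(x))(\lambda y^2-f(x))=0$; loops are allowed. -}

module Defs where

open import Level using (0ℓ)
open import Data.Nat using (ℕ)
open import Data.Fin using (Fin)
open import Data.Bool using (Bool)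
open import Data.List using (List; []; _∷_)
open import Data.Product using (∃; ∃-syntax; Σ; _,_)
open import Relation.Binary.PropositionalEquality using (_≡_; _≢_)
open import Relation.Nullary using (¬_)
open import Algebra.Structures using (IsCommutativeRing)
open import Function.Bundles using (_⤖_)
open import Function.Definitions using (Bijective)

record FiniteField (q : ℕ) : Set₁ where
  infixl 6 _+_
  infixl 7 _*_
  field
    Carrier : Set
    _+_ _*_ : Carrier → Carrier → Carrier
    -_ : Carrier → Carrier
    0# 1# : Carrier
    isCommutativeRing : IsCommutativeRing _≡_ _+_ _*_ -_ 0# 1#
    0≢1 : 0# ≢ 1#
    inverse : ∀ x → x ≢ 0# → ∃[ y ] (x * y ≡ 1#)
    card : Carrier ⤖ Fin q

  _-_ : Carrier → Carrier → Carrier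
  a - b = a + (- b)

  -- polynomials over the field as coefficient lists [a₀, a₁, …, aₙ]
  Poly : Set
  Poly = List Carrier

  eval : Poly → Carrier → Carrier
  eval [] x = 0#
  eval (a ∷ as) x = a + x * eval as x

  IsSquare : Carrier → Set
  IsSquare a = ∃[ y ] (y * y ≡ a)

  IsPermutationPolynomial : Poly → Set
  IsPermutationPolynomial f = Bijective _≡_ _≡_ (eval f)

  Edge : Carrier → Poly → Carrier → Carrier → Set
  Edge λ' f x y = ((y * y) - eval f x) * ((λ' * (y * y)) - eval f x) ≡ 0#

  -- G(λ,f) is bipartite: a 2-colouring (partition into S₁ = colour true,
  -- S₂ = colour false) with no edge (loops included) inside one class.
  IsBipartite : Carrier → Poly → Set
  IsBipartite λ' f = Σ (Carrier → Bool) λ c → (∀ x y → Edge λ' f x y → c x ≢ c y)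

module Submission where

-- Every vertex y has an in-neighbour f⁻¹(y²) and an in-neighbour f⁻¹(λ'y²). Taking the first for one of
-- ±y and the second for the other gives an injective, hence bijective, choice of in-neighbour, because y²
-- and λ'z² only meet at 0. A proper 2-colouring changes colour along each of these edges, so this
-- permutation of the field swaps the two colour classes; they have equal size and q would be even.

open import Level using (0ℓ)
open import Data.Bool using (Bool; true; false; not; if_then_else_)
open import Data.Bool.Properties using (¬-not)
open import Data.Fin as Fin using (Fin; zero; suc; toℕ; punchOut)
open import Data.Fin.Permutation using (Permutation′; permutation; _⟨$⟩ʳ_)
open import Data.Fin.Properties using (any?; punchOut-injective; injective⇒≤; toℕ-injective)
open import Data.Nat as ℕ using (ℕ; _^_; _≥_)
open import Data.Nat.Divisibility using (_∣_; divides; ∣1⇒≡1)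
open import Data.Nat.Primality using (Prime; prime[2]; euclidsLemma; prime⇒irreducible)
import Data.Nat.Properties as ℕₚ
open import Data.Product using (∃; Σ; _,_; _×_; proj₁; proj₂)
open import Data.Sum as Sum using (_⊎_; inj₁; inj₂)
open import Function using (_∘_; _↔_; Inverse; Bijection)
open import Function.Definitions using (Injective)
open import Function.Properties.Bijection using (⤖⇒↔)
open import Algebra.Bundles using (CommutativeRing)
open import Algebra.Properties.CommutativeMonoid.Sum ℕₚ.+-0-commutativeMonoid using (sum; sum-permute; sum-cong-≗)
open import Relation.Binary.Definitions using (DecidableEquality)
open import Relation.Binary.PropositionalEquality
open import Relation.Nullary using (¬_; Dec; yes; no; contradiction)
open import Relation.Nullary.Decidable using (via-injection)
open import Defs

injective⇒surjective : ∀ {n} {h : Fin n → Fin n} → Injective _≡_ _≡_ h → ∀ y → ∃ λ x → h x ≡ y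
injective⇒surjective {ℕ.zero} _ ()
injective⇒surjective {ℕ.suc m} {h} h-injective y with any? (λ x → h x Fin.≟ y)
... | yes hit = hit
... | no miss = contradiction (injective⇒≤ punchOut∘h-injective) ℕₚ.1+n≰n
  where
  avoids : ∀ x → y ≢ h x
  avoids x y≡hx = miss (x , sym y≡hx)

  punchOut∘h-injective : Injective _≡_ _≡_ (λ x → punchOut (avoids x))
  punchOut∘h-injective eq = h-injective (punchOut-injective (avoids _) (avoids _) eq)

injective⇒permutation : ∀ {n} {h : Fin n → Fin n} → Injective _≡_ _≡_ h →
  Σ (Permutation′ n) λ π → ∀ i → π ⟨$⟩ʳ i ≡ h i
injective⇒permutation {h = h} h-injective = permutation h h⁻¹ h∘h⁻¹ h⁻¹∘h , λ _ → refl
  where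
  h⁻¹ : Fin _ → Fin _
  h⁻¹ y = proj₁ (injective⇒surjective h-injective y)

  h∘h⁻¹ : ∀ y → h (h⁻¹ y) ≡ y
  h∘h⁻¹ y = proj₂ (injective⇒surjective h-injective y)

  h⁻¹∘h : ∀ x → h⁻¹ (h x) ≡ x
  h⁻¹∘h x = h-injective (h∘h⁻¹ (h x))

countTrue : ∀ {n} → (Fin n → Bool) → ℕ
countTrue c = sum (λ i → if c i then 1 else 0)

countTrue+countTrue∘not : ∀ {n} (c : Fin n → Bool) → countTrue c ℕ.+ countTrue (not ∘ c) ≡ n
countTrue+countTrue∘not {ℕ.zero} c = refl
countTrue+countTrue∘not {ℕ.suc n} c with c zero | countTrue+countTrue∘not (c ∘ suc)
... | true  | ih = cong ℕ.suc ih
... | false | ih = trans (ℕₚ.+-suc (countTrue (c ∘ suc)) _) (cong ℕ.suc ih)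

colour-reversing-injection⇒2∣ : ∀ {n} {h : Fin n → Fin n} → Injective _≡_ _≡_ h →
  (c : Fin n → Bool) → (∀ i → c (h i) ≡ not (c i)) → 2 ∣ n
colour-reversing-injection⇒2∣ {n} h-injective c reverses =
  divides T (trans (sym (countTrue+countTrue∘not c)) (begin
    T ℕ.+ countTrue (not ∘ c) ≡⟨ cong (T ℕ.+_) (sym T≡countTrue∘not) ⟩
    T ℕ.+ T                   ≡⟨ cong (T ℕ.+_) (sym (ℕₚ.+-identityʳ T)) ⟩
    2 ℕ.* T                   ≡⟨ ℕₚ.*-comm 2 T ⟩
    T ℕ.* 2                   ∎))
  where
  open ≡-Reasoning
  T = countTrue c
  π = injective⇒permutation h-injective
  T≡countTrue∘not : T ≡ countTrue (not ∘ c)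
  T≡countTrue∘not = trans (sum-permute _ (proj₁ π))
    (sum-cong-≗ λ i → cong (λ b → if b then 1 else 0) (trans (cong c (proj₂ π i)) (reverses i)))

colour-reversing-injection⇒2∣card : ∀ {n} {A : Set} → A ↔ Fin n → {h : A → A} → Injective _≡_ _≡_ h →
  (c : A → Bool) → (∀ a → c (h a) ≢ c a) → 2 ∣ n
colour-reversing-injection⇒2∣card A↔Fin {h} h-injective c reverses =
  colour-reversing-injection⇒2∣ {h = to ∘ h ∘ from} conjugate-injective (c ∘ from) conjugate-reverses
  where
  open Inverse A↔Fin

  to-injective : ∀ {x y} → to x ≡ to y → x ≡ y
  to-injective {x} {y} eq = trans (sym (strictlyInverseʳ x)) (trans (cong from eq) (strictlyInverseʳ y))

  conjugate-injective : Injective _≡_ _≡_ (to ∘ h ∘ from)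
  conjugate-injective {i} {j} eq =
    trans (sym (strictlyInverseˡ i)) (trans (cong to (h-injective (to-injective eq))) (strictlyInverseˡ j))

  conjugate-reverses : ∀ i → c (from (to (h (from i)))) ≡ not (c (from i))
  conjugate-reverses i = trans (cong c (strictlyInverseʳ _)) (¬-not (reverses (from i)))

2∤odd-prime^ : ∀ {p} → Prime p → p ≢ 2 → ∀ k → ¬ 2 ∣ p ^ k
2∤odd-prime^ _ _ ℕ.zero 2∣1 with () ← ∣1⇒≡1 2∣1
2∤odd-prime^ {p} p-prime p≢2 (ℕ.suc k) 2∣p^k+1 with euclidsLemma p (p ^ k) prime[2] 2∣p^k+1
... | inj₂ 2∣p^k = 2∤odd-prime^ p-prime p≢2 k 2∣p^k
... | inj₁ 2∣p with prime⇒irreducible p-prime 2∣p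
...   | inj₁ ()
...   | inj₂ 2≡p = p≢2 (sym 2≡p)

module _ {q : ℕ} (F : FiniteField q) where

  open FiniteField F using (Carrier; card; inverse; eval; Poly; IsSquare; IsPermutationPolynomial; Edge; IsBipartite)

  commutativeRing : CommutativeRing 0ℓ 0ℓ
  commutativeRing = record { isCommutativeRing = FiniteField.isCommutativeRing F }

  open CommutativeRing commutativeRing hiding (Carrier; refl; sym; trans; reflexive; isEquivalence; setoid)
  open import Algebra.Properties.Ring ring using (-‿involutive; [y-z]x≈yx-zx; x∙y⁻¹≈ε⇒x≈y; +-inverseˡ-unique)
  open import Algebra.Properties.CommutativeSemigroup *-commutativeSemigroup using (interchange)
  open ≡-Reasoning

  _≟_ : DecidableEquality Carrier
  _≟_ = via-injection (Bijection.injection card) Fin._≟_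

  *-cancelˡ-≢0 : ∀ {x} → x ≢ 0# → ∀ {y z} → x * y ≡ x * z → y ≡ z
  *-cancelˡ-≢0 {x} x≢0 {y} {z} xy≡xz with x⁻¹ , xx⁻¹≡1 ← inverse x x≢0 = begin
    y              ≡⟨ sym (*-identityˡ y) ⟩
    1# * y         ≡⟨ cong (_* y) (trans (sym xx⁻¹≡1) (*-comm x x⁻¹)) ⟩
    (x⁻¹ * x) * y  ≡⟨ *-assoc x⁻¹ x y ⟩
    x⁻¹ * (x * y)  ≡⟨ cong (x⁻¹ *_) xy≡xz ⟩
    x⁻¹ * (x * z)  ≡⟨ sym (*-assoc x⁻¹ x z) ⟩
    (x⁻¹ * x) * z  ≡⟨ cong (_* z) (trans (*-comm x⁻¹ x) xx⁻¹≡1) ⟩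
    1# * z         ≡⟨ *-identityˡ z ⟩
    z              ∎

  *-integral : ∀ x y → x * y ≡ 0# → x ≡ 0# ⊎ y ≡ 0#
  *-integral x y xy≡0 with x ≟ 0#
  ... | yes x≡0 = inj₁ x≡0
  ... | no  x≢0 = inj₂ (*-cancelˡ-≢0 x≢0 (trans xy≡0 (sym (zeroʳ x))))

  square≡0⇒≡0 : ∀ x → x * x ≡ 0# → x ≡ 0#
  square≡0⇒≡0 x xx≡0 with *-integral x x xx≡0
  ... | inj₁ x≡0 = x≡0
  ... | inj₂ x≡0 = x≡0

  telescope : ∀ a b c → (a + - b) + (b + - c) ≡ a + - c
  telescope a b c = begin
    (a + - b) + (b + - c)  ≡⟨ +-assoc a (- b) (b + - c) ⟩
    a + (- b + (b + - c))  ≡⟨ cong (a +_) (sym (+-assoc (- b) b (- c))) ⟩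
    a + ((- b + b) + - c)  ≡⟨ cong (λ t → a + (t + - c)) (-‿inverseˡ b) ⟩
    a + (0# + - c)         ≡⟨ cong (a +_) (+-identityˡ (- c)) ⟩
    a + - c                ∎

  difference-of-squares : ∀ y z → (y + - z) * (y + z) ≡ y * y + - (z * z)
  difference-of-squares y z = begin
    (y + - z) * (y + z)                          ≡⟨ distribˡ (y + - z) y z ⟩
    (y + - z) * y + (y + - z) * z                ≡⟨ cong₂ _+_ ([y-z]x≈yx-zx y y z) ([y-z]x≈yx-zx z y z) ⟩
    (y * y + - (z * y)) + (y * z + - (z * z))    ≡⟨ cong (λ t → (y * y + - t) + (y * z + - (z * z))) (*-comm z y) ⟩
    (y * y + - (y * z)) + (y * z + - (z * z))    ≡⟨ telescope (y * y) (y * z) (z * z) ⟩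
    y * y + - (z * z)                            ∎

  square-injective-up-to-sign : ∀ y z → y * y ≡ z * z → y ≡ z ⊎ y ≡ - z
  square-injective-up-to-sign y z yy≡zz
    with *-integral (y + - z) (y + z)
           (trans (difference-of-squares y z) (trans (cong (_+ - (z * z)) yy≡zz) (-‿inverseʳ (z * z))))
  ... | inj₁ y-z≡0 = inj₁ (x∙y⁻¹≈ε⇒x≈y y z y-z≡0)
  ... | inj₂ y+z≡0 = inj₂ (+-inverseˡ-unique y z y+z≡0)

  index : Carrier → ℕ
  index x = toℕ (Bijection.to card x)

  index-injective : ∀ {x y} → index x ≡ index y → x ≡ y
  index-injective eq = Bijection.injective card (toℕ-injective eq)

  -- A choice of sign read off the enumeration card: of each pair {x, - x} with x ≢ 0#, exactly one is positive.
  Positive : Carrier → Set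
  Positive x = index x ℕ.< index (- x)

  positive? : ∀ x → Dec (Positive x)
  positive? x = index x ℕ.<? index (- x)

  positive-neg⇒¬positive : ∀ x → Positive (- x) → ¬ Positive x
  positive-neg⇒¬positive x -x-positive x-positive
    rewrite -‿involutive x = ℕₚ.<-asym -x-positive x-positive

  ¬positive-both⇒neg≡ : ∀ x → ¬ Positive (- x) → ¬ Positive x → - x ≡ x
  ¬positive-both⇒neg≡ x -x-nonpositive x-nonpositive rewrite -‿involutive x =
    index-injective (ℕₚ.≤-antisym (ℕₚ.≮⇒≥ x-nonpositive) (ℕₚ.≮⇒≥ -x-nonpositive))

  Edge-intro : ∀ λ' f x y → eval f x ≡ y * y ⊎ eval f x ≡ λ' * (y * y) → Edge λ' f x y
  Edge-intro λ' f x y (inj₁ fx≡y²) rewrite fx≡y² =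
    trans (cong (_* (λ' * (y * y) + - (y * y))) (-‿inverseʳ (y * y))) (zeroˡ _)
  Edge-intro λ' f x y (inj₂ fx≡λ'y²) rewrite fx≡λ'y² =
    trans (cong ((y * y + - (λ' * (y * y))) *_) (-‿inverseʳ (λ' * (y * y)))) (zeroʳ _)

  module _ {λ' : Carrier} (λ'-nonsquare : ¬ IsSquare λ') where

    nonsquare≢0 : λ' ≢ 0#
    nonsquare≢0 λ'≡0 = λ'-nonsquare (0# , trans (zeroˡ 0#) (sym λ'≡0))

    square≡nonsquare*square⇒≡0 : ∀ y z → y * y ≡ λ' * (z * z) → y ≡ 0# × z ≡ 0#
    square≡nonsquare*square⇒≡0 y z yy≡λ'zz with z ≟ 0#
    ... | yes refl = square≡0⇒≡0 y (trans yy≡λ'zz (trans (cong (λ' *_) (zeroˡ 0#)) (zeroʳ λ'))) , refl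
    ... | no z≢0 with z⁻¹ , zz⁻¹≡1 ← inverse z z≢0 = contradiction (y * z⁻¹ , yz⁻¹-square) λ'-nonsquare
      where
      yz⁻¹-square : (y * z⁻¹) * (y * z⁻¹) ≡ λ'
      yz⁻¹-square = begin
        (y * z⁻¹) * (y * z⁻¹)       ≡⟨ interchange y z⁻¹ y z⁻¹ ⟩
        (y * y) * (z⁻¹ * z⁻¹)       ≡⟨ cong (_* (z⁻¹ * z⁻¹)) yy≡λ'zz ⟩
        (λ' * (z * z)) * (z⁻¹ * z⁻¹) ≡⟨ *-assoc λ' (z * z) (z⁻¹ * z⁻¹) ⟩
        λ' * ((z * z) * (z⁻¹ * z⁻¹)) ≡⟨ cong (λ' *_) (interchange z z z⁻¹ z⁻¹) ⟩
        λ' * ((z * z⁻¹) * (z * z⁻¹)) ≡⟨ cong (λ t → λ' * (t * t)) zz⁻¹≡1 ⟩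
        λ' * (1# * 1#)               ≡⟨ cong (λ' *_) (*-identityˡ 1#) ⟩
        λ' * 1#                      ≡⟨ *-identityʳ λ' ⟩
        λ'                           ∎

    twistedSquare : Carrier → Carrier
    twistedSquare y with positive? y
    ... | yes _ = y * y
    ... | no  _ = λ' * (y * y)

    twistedSquare-cases : ∀ y → twistedSquare y ≡ y * y ⊎ twistedSquare y ≡ λ' * (y * y)
    twistedSquare-cases y with positive? y
    ... | yes _ = inj₁ refl
    ... | no  _ = inj₂ refl

    twistedSquare-injective : Injective _≡_ _≡_ twistedSquare
    twistedSquare-injective {y} {z} eq with positive? y | positive? z
    ... | yes y⁺ | yes z⁺ with square-injective-up-to-sign y z eq
    ...   | inj₁ y≡z  = y≡z
    ...   | inj₂ refl = contradiction z⁺ (positive-neg⇒¬positive z y⁺)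
    twistedSquare-injective {y} {z} eq | no y⁻ | no z⁻
      with square-injective-up-to-sign y z (*-cancelˡ-≢0 nonsquare≢0 eq)
    ...   | inj₁ y≡z  = y≡z
    ...   | inj₂ refl = ¬positive-both⇒neg≡ z y⁻ z⁻
    twistedSquare-injective {y} {z} eq | yes _ | no _ =
      let y≡0 , z≡0 = square≡nonsquare*square⇒≡0 y z eq in trans y≡0 (sym z≡0)
    twistedSquare-injective {y} {z} eq | no _ | yes _ =
      let z≡0 , y≡0 = square≡nonsquare*square⇒≡0 z y (sym eq) in trans y≡0 (sym z≡0)

    module _ {f : Poly} (f-permutes : IsPermutationPolynomial f) where

      f⁻¹ : Carrier → Carrier
      f⁻¹ w = proj₁ (proj₂ f-permutes w)

      f∘f⁻¹ : ∀ w → eval f (f⁻¹ w) ≡ w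
      f∘f⁻¹ w = proj₂ (proj₂ f-permutes w) refl

      predecessor : Carrier → Carrier
      predecessor = f⁻¹ ∘ twistedSquare

      predecessor-injective : Injective _≡_ _≡_ predecessor
      predecessor-injective eq =
        twistedSquare-injective (trans (sym (f∘f⁻¹ _)) (trans (cong (eval f) eq) (f∘f⁻¹ _)))

      predecessor-edge : ∀ y → Edge λ' f (predecessor y) y
      predecessor-edge y =
        Edge-intro λ' f _ y (Sum.map (trans (f∘f⁻¹ _)) (trans (f∘f⁻¹ _)) (twistedSquare-cases y))

      bipartite⇒2∣order : IsBipartite λ' f → 2 ∣ q
      bipartite⇒2∣order (c , proper) =
        colour-reversing-injection⇒2∣card (⤖⇒↔ card) predecessor-injective c
          (λ y → proper (predecessor y) y (predecessor-edge y))

proposition2p3 : ∀ {p k : ℕ} → Prime p → p ≢ 2 → k ≥ 1 →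
    (F : FiniteField (p ^ k)) → (λ' : FiniteField.Carrier F) →
    ¬ FiniteField.IsSquare F λ' →
    (f : FiniteField.Poly F) → FiniteField.IsPermutationPolynomial F f →
    ¬ FiniteField.IsBipartite F λ' f
proposition2p3 {k = k} p-prime p≢2 _ F λ' λ'-nonsquare f f-permutes bipartite =
  2∤odd-prime^ p-prime p≢2 k (bipartite⇒2∣order F λ'-nonsquare {f} f-permutes bipartite)
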